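{- Let $\mathcal{S}$ be a bounded system with interaction formula $\Gamma$, written in DNF as $\Gamma=\bigvee_{k=1}^N\bigwedge_{\ell=1}^{M_k}p_{k\ell}$, and let $\beta$ be a boolean valuation of the state variables. Then $\beta$ is a model of $\Theta(\Gamma)\wedge\mathrm{Init}(\mathcal{S})$ if and only if $\{s\mid\beta(s)=\top\}$ is a marked trap of $\mathcal{N}_\mathcal{S}$. Moreover, $\beta$ is a minimal model of $\Theta(\Gamma)\wedge\mathrm{Init}(\mathcal{S})$ if and only if $\{s\mid\beta(s)=\top\}$ is a minimal marked trap of $\mathcal{N}_\mathcal{S}$.
   Context: A component is a tuple $\mathcal{C}=\langle \mathsf{P},\mathsf{S},s_0,\Delta\rangle$ with a finite set $\mathsf{P}$ of ports, a finite set $\mathsf{S}$ of states, an initial state $s_0$ and transitions $\Delta\subseteq\mathsf{S}\times\mathsf{P}\times\mathsf{S}$ written $s\xrightarrow{p}s'$; no two different transitions carry the same port. A bounded system $\mathcal{S}=\langle\mathcal{C}^1,\ldots,\mathcal{C}^n,\Gamma\rangle$ consists of components $\mathcal{C}^k=\langle\mathsf{P}^k,\mathsf{S}^k,s_0^k,\Delta^k\rangle$ (pairwise disjoint port and state sets) and a positive boolean formula $\Gamma$ over the ports. States are used as propositional variables. For valuations, $\beta_1\subseteq\beta_2$ means $\beta_1(a)=\top\Rightarrow\beta_2(a)=\top$; minimal models are models minimal w.r.t. $\subseteq$. The marked Petri net $\mathcal{N}_\mathcal{S}$ has places $\bigcup_k\mathsf{S}^k$, one transition $\mathfrak{t}_\beta$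 per minimal model $\beta$ of $\Gamma$ with edges $(s,\mathfrak{t}_\beta),(\mathfrak{t}_\beta,s')$ for each $k$ and each $s\xrightarrow{p}s'\in\Delta^k$ with $\beta(p)=\top$, and initial marking marking exactly the initial states $s_0^k$. A set $W$ of places is a trap if every transition having an input place in $W$ has an output place in $W$; marked if it contains an initially marked place; a minimal marked trap is a marked trap none of whose strict subsets is a marked trap. For a port $p$ with (unique) transition $s\xrightarrow{p}s'$ let ${}^\bullet p:=s$ and $p^\bullet:=s'$; if $p$ labels no transition, ${}^\bullet p=p^\bullet:=\bot$. The trap constraint is $\Theta(\Gamma):=\bigwedge_{k=1}^N\big(\bigvee_{\ell=1}^{M_k}{}^\bullet p_{k\ell}\big)\rightarrow\big(\bigvee_{\ell=1}^{M_k}p_{k\ell}^\bullet\big)$ and $\mathrm{Init}(\mathcal{S}):=\bigvee_{k=1}^n s_0^k$.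
   Formalization: The DNF $\Gamma=\bigvee_{k=1}^N\bigwedge_{\ell=1}^{M_k}p_{k\ell}$ has no disjunct whose set of ports strictly contains the set of ports of another disjunct. The paper assumes this as well. -}

module Defs where

open import Data.Nat using (ℕ)
open import Data.Bool using (Bool; true; false; _∧_; _∨_; not)
open import Data.Fin using (Fin)
open import Data.Fin.Subset using (Subset; _∈_; _⊂_)
open import Data.Maybe using (Maybe; just; nothing; maybe′)
open import Data.Product using (_×_; _,_; ∃; ∃-syntax; Σ; proj₁; proj₂)
open import Data.List using (List; map; foldr; allFin)
import Data.List.Membership.Propositional as LM
open import Relation.Binary.PropositionalEquality using (_≡_)
open import Relation.Nullary using (¬_)

infixr 6 _∧f_
infixr 5 _∨f_
infixr 4 _⇒f_

data Form (V : Set) : Set where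
  var  : V → Form V
  ⊤f   : Form V
  ⊥f   : Form V
  _∧f_ : Form V → Form V → Form V
  _∨f_ : Form V → Form V → Form V
  _⇒f_ : Form V → Form V → Form V

⟦_⟧ : {V : Set} → Form V → (V → Bool) → Bool
⟦ var a ⟧ β = β a
⟦ ⊤f ⟧ β = true
⟦ ⊥f ⟧ β = false
⟦ φ ∧f ψ ⟧ β = ⟦ φ ⟧ β ∧ ⟦ ψ ⟧ β
⟦ φ ∨f ψ ⟧ β = ⟦ φ ⟧ β ∨ ⟦ ψ ⟧ β
⟦ φ ⇒f ψ ⟧ β = not (⟦ φ ⟧ β) ∨ ⟦ ψ ⟧ β

Model : {V : Set} → Form V → (V → Bool) → Set
Model φ β = ⟦ φ ⟧ β ≡ true

_⊆v_ : {V : Set} → (V → Bool) → (V → Bool) → Set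
β₁ ⊆v β₂ = ∀ a → β₁ a ≡ true → β₂ a ≡ true

MinimalModel : {V : Set} → Form V → (V → Bool) → Set
MinimalModel φ β = Model φ β × (∀ β' → Model φ β' → β' ⊆v β → β ⊆v β')

⋁ : {V : Set} → List (Form V) → Form V
⋁ = foldr _∨f_ ⊥f

⋀ : {V : Set} → List (Form V) → Form V
⋀ = foldr _∧f_ ⊤f

DNF : Set → Set
DNF V = List (List V)

dnf→form : {V : Set} → DNF V → Form V
dnf→form Γ = ⋁ (map (λ D → ⋀ (map var D)) Γ)

-- States of all components are Fin nS, ports of all components Fin nP
-- (so the per-component sets are disjoint by construction); compS / compP
-- assign each state / port its component. Each port labels at most one
-- transition: trans p = just (s , s') encodes s -p-> s', nothing means p
-- labels no transition.

record System : Set where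
  field
    n   : ℕ
    nS  : ℕ
    nP  : ℕ
    compS : Fin nS → Fin n
    compP : Fin nP → Fin n
    init  : Fin n → Fin nS
    init-comp  : ∀ k → compS (init k) ≡ k
    trans : Fin nP → Maybe (Fin nS × Fin nS)
    trans-comp : ∀ p s s' → trans p ≡ just (s , s') →
                 (compS s ≡ compP p) × (compS s' ≡ compP p)
    Γ : DNF (Fin nP)

  -- •p and p• as formulas over states (⊥ if p labels no transition)
  •_ : Fin nP → Form (Fin nS)
  • p = maybe′ (λ t → var (proj₁ t)) ⊥f (trans p)

  _• : Fin nP → Form (Fin nS)
  p • = maybe′ (λ t → var (proj₂ t)) ⊥f (trans p)

  Θ : Form (Fin nS)
  Θ = ⋀ (map (λ D → ⋁ (map •_ D) ⇒f ⋁ (map _• D)) Γ)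

  Init : Form (Fin nS)
  Init = ⋁ (map (λ k → var (init k)) (allFin n))

record PetriNet : Set₁ where
  field
    nPl    : ℕ
    Trans  : Set
    inArc  : Fin nPl → Trans → Set
    outArc : Trans → Fin nPl → Set
    marked : Fin nPl → Set

module _ (N : PetriNet) where
  open PetriNet N

  Trap : Subset nPl → Set
  Trap W = ∀ t → (∃[ s ] (inArc s t × s ∈ W)) → ∃[ s ] (outArc t s × s ∈ W)

  IsMarked : Subset nPl → Set
  IsMarked W = ∃[ s ] (marked s × s ∈ W)

  MarkedTrap : Subset nPl → Set
  MarkedTrap W = Trap W × IsMarked W

  MinimalMarkedTrap : Subset nPl → Set
  MinimalMarkedTrap W = MarkedTrap W × (∀ W' → W' ⊂ W → ¬ MarkedTrap W')

-- The net N_S: one transition t_β per minimal model β of Γ.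
net : System → PetriNet
net S = record
  { nPl    = nS
  ; Trans  = Σ (Fin nP → Bool) (MinimalModel (dnf→form Γ))
  ; inArc  = λ s t → ∃[ p ] (proj₁ t p ≡ true × ∃[ s' ] (trans p ≡ just (s , s')))
  ; outArc = λ t s' → ∃[ p ] (proj₁ t p ≡ true × ∃[ s ] (trans p ≡ just (s , s')))
  ; marked = λ s → ∃[ k ] (init k ≡ s)
  }
  where open System S

-- Irredundant DNF: no disjunct's port set strictly contains another's,
-- i.e. the disjuncts are exactly the minimal models of Γ.
IrredundantDNF : {V : Set} → DNF V → Set
IrredundantDNF Γ = ∀ D D' → D LM.∈ Γ → D' LM.∈ Γ →
  (∀ p → p LM.∈ D → p LM.∈ D') → (∀ p → p LM.∈ D' → p LM.∈ D)

module Submission where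

-- The proof has three layers.
--  * Semantics of big disjunctions/conjunctions and of DNF formulas; with an
--    irredundant DNF, the minimal models of Γ are precisely the indicator
--    valuations of its disjuncts, so the net transitions t_γ correspond to
--    the disjuncts of Γ.
--  * For a set X of ports, the "trap condition" says: if some port of X
--    leaves a state in β then some port of X enters a state in β.  The clause
--    of Θ for a disjunct D is the trap condition for D, and the trap property
--    for t_γ is the trap condition for the ports true under γ; as both range over
--    the same port sets, Θ holds iff tabulate β is a trap.  Init holds iff
--    the set is marked.
--  * Valuations ordered by ⊆v and subsets ordered by ⊆ are isomorphic via
--    tabulate/lookup, so minimality transfers along any pointwise
--    equivalence of predicates; this yields the second half from the first.

open import Defs
open import Data.Bool using (Bool; true; false; _∧_; _∨_; not)
open import Data.Empty using (⊥; ⊥-elim)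
open import Data.Fin using (Fin)
open import Data.Fin.Properties using (_≟_)
open import Data.Fin.Subset using (Subset; _⊂_)
import Data.Fin.Subset as Subset
open import Data.List using (List; []; _∷_; map; allFin)
open import Data.List.Relation.Unary.Any using (here; there)
open import Data.List.Membership.Propositional using (_∈_)
open import Data.List.Membership.Propositional.Properties using (∈-allFin)
import Data.List.Membership.DecPropositional as DecMembership
open import Data.Maybe using (just; nothing)
open import Data.Product using (_×_; _,_; ∃-syntax; proj₁; proj₂)
open import Data.Product.Function.NonDependent.Propositional using (_×-⇔_)
open import Data.Sum using (_⊎_; inj₁; inj₂)
open import Data.Vec using (tabulate; lookup)
open import Data.Vec.Properties using (lookup∘tabulate; tabulate∘lookup; []=⇒lookup; lookup⇒[]=)
open import Function.Bundles using (_⇔_; mk⇔; module Equivalence)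
open import Function.Properties.Equivalence using () renaming (trans to ⇔-trans; sym to ⇔-sym)
open import Relation.Nullary using (¬_; yes; no; does)
open import Relation.Binary.PropositionalEquality using (_≡_; refl; sym; subst) renaming (trans to ≡-trans)

open Equivalence using (to; from)

∧-true : ∀ a b → a ∧ b ≡ true ⇔ (a ≡ true × b ≡ true)
∧-true true  b = mk⇔ (λ e → refl , e) proj₂
∧-true false b = mk⇔ (λ ()) (λ { (() , _) })

∨-true : ∀ a b → a ∨ b ≡ true ⇔ (a ≡ true ⊎ b ≡ true)
∨-true true  b = mk⇔ (λ _ → inj₁ refl) (λ _ → refl)
∨-true false b = mk⇔ inj₂ (λ { (inj₁ ()) ; (inj₂ e) → e })

⇒-true : ∀ a b → not a ∨ b ≡ true ⇔ (a ≡ true → b ≡ true)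
⇒-true true  b = mk⇔ (λ e _ → e) (λ f → f refl)
⇒-true false b = mk⇔ (λ _ ()) (λ _ → refl)

module _ {A V : Set} (f : A → Form V) (β : V → Bool) where

  ⋁-true : ∀ L → ⟦ ⋁ (map f L) ⟧ β ≡ true ⇔ (∃[ x ] (x ∈ L × ⟦ f x ⟧ β ≡ true))
  ⋁-true []      = mk⇔ (λ ()) (λ { (_ , () , _) })
  ⋁-true (y ∷ L) = mk⇔ some-disjunct disjunction
    where
    some-disjunct : ⟦ ⋁ (map f (y ∷ L)) ⟧ β ≡ true → ∃[ x ] (x ∈ y ∷ L × ⟦ f x ⟧ β ≡ true)
    some-disjunct e with to (∨-true _ _) e
    ... | inj₁ fy = y , here refl , fy
    ... | inj₂ rest with to (⋁-true L) rest
    ...   | x , x∈L , fx = x , there x∈L , fx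

    disjunction : ∃[ x ] (x ∈ y ∷ L × ⟦ f x ⟧ β ≡ true) → ⟦ ⋁ (map f (y ∷ L)) ⟧ β ≡ true
    disjunction (x , here refl , fx)  = from (∨-true _ _) (inj₁ fx)
    disjunction (x , there x∈L , fx) = from (∨-true _ _) (inj₂ (from (⋁-true L) (x , x∈L , fx)))

  ⋀-true : ∀ L → ⟦ ⋀ (map f L) ⟧ β ≡ true ⇔ (∀ x → x ∈ L → ⟦ f x ⟧ β ≡ true)
  ⋀-true []      = mk⇔ (λ _ _ ()) (λ _ → refl)
  ⋀-true (y ∷ L) = mk⇔ every-conjunct conjunction
    where
    every-conjunct : ⟦ ⋀ (map f (y ∷ L)) ⟧ β ≡ true → ∀ x → x ∈ y ∷ L → ⟦ f x ⟧ β ≡ true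
    every-conjunct e x (here refl)  = proj₁ (to (∧-true _ _) e)
    every-conjunct e x (there x∈L) = to (⋀-true L) (proj₂ (to (∧-true _ _) e)) x x∈L

    conjunction : (∀ x → x ∈ y ∷ L → ⟦ f x ⟧ β ≡ true) → ⟦ ⋀ (map f (y ∷ L)) ⟧ β ≡ true
    conjunction h = from (∧-true _ _)
      (h y (here refl) , from (⋀-true L) (λ x x∈L → h x (there x∈L)))

∈⇔lookup : ∀ {n} (W : Subset n) s → s Subset.∈ W ⇔ lookup W s ≡ true
∈⇔lookup W s = mk⇔ []=⇒lookup (lookup⇒[]= s W)

∈-tabulate : ∀ {n} (β : Fin n → Bool) s → s Subset.∈ tabulate β ⇔ β s ≡ true
∈-tabulate β s = ⇔-trans (∈⇔lookup (tabulate β) s)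
  (mk⇔ (≡-trans (sym (lookup∘tabulate β s))) (≡-trans (lookup∘tabulate β s)))

-- tabulate is an order isomorphism from (valuations, ⊆v) to (subsets, ⊆),
-- so a predicate on valuations that agrees with a predicate on subsets has
-- ⊆v-minimal elements exactly where the latter has ⊂-minimal ones.
minimality-transfer : ∀ {n} (P : (Fin n → Bool) → Set) (Q : Subset n → Set) →
  (∀ β → P β ⇔ Q (tabulate β)) → ∀ β →
  (P β × (∀ β' → P β' → β' ⊆v β → β ⊆v β')) ⇔ (Q (tabulate β) × (∀ W → W ⊂ tabulate β → ¬ Q W))
minimality-transfer P Q P⇔Q β = mk⇔ to-subsets to-valuations
  where
  to-subsets : P β × (∀ β' → P β' → β' ⊆v β → β ⊆v β') →
               Q (tabulate β) × (∀ W → W ⊂ tabulate β → ¬ Q W)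
  to-subsets (Pβ , minimal) = to (P⇔Q β) Pβ , no-smaller
    where
    no-smaller : ∀ W → W ⊂ tabulate β → ¬ Q W
    no-smaller W (W⊆ , x , x∈ , x∉W) QW = x∉W (from (∈⇔lookup W x) (β⊆W x (to (∈-tabulate β x) x∈)))
      where
      β⊆W : β ⊆v lookup W
      β⊆W = minimal (lookup W)
        (from (P⇔Q (lookup W)) (subst Q (sym (tabulate∘lookup W)) QW))
        (λ a e → to (∈-tabulate β a) (W⊆ (from (∈⇔lookup W a) e)))

  to-valuations : Q (tabulate β) × (∀ W → W ⊂ tabulate β → ¬ Q W) →
                  P β × (∀ β' → P β' → β' ⊆v β → β ⊆v β')
  to-valuations (Qβ , minimal) = from (P⇔Q β) Qβ , larger
    where
    larger : ∀ β' → P β' → β' ⊆v β → β ⊆v β'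
    larger β' Pβ' β'⊆β a βa with β' a in β'a
    ... | true  = refl
    ... | false = ⊥-elim (minimal (tabulate β') strictly-smaller (to (P⇔Q β') Pβ'))
      where
      strictly-smaller : tabulate β' ⊂ tabulate β
      strictly-smaller =
        (λ {s} m → from (∈-tabulate β s) (β'⊆β s (to (∈-tabulate β' s) m))) ,
        a , from (∈-tabulate β a) βa ,
        λ m → false≢true (≡-trans (sym β'a) (to (∈-tabulate β' a) m))
        where
        false≢true : false ≡ true → ⊥
        false≢true ()

indicator : ∀ {n} → List (Fin n) → Fin n → Bool
indicator D p = does (DecMembership._∈?_ _≟_ p D)

HasSupport : ∀ {n} → (Fin n → Bool) → List (Fin n) → Set
HasSupport t D = ∀ p → t p ≡ true ⇔ p ∈ D

indicator-support : ∀ {n} (D : List (Fin n)) → HasSupport (indicator D) D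
indicator-support D p with DecMembership._∈?_ _≟_ p D
... | yes p∈D = mk⇔ (λ _ → p∈D) (λ _ → refl)
... | no  p∉D = mk⇔ (λ ()) (λ p∈D → ⊥-elim (p∉D p∈D))

module _ {n} (Γ : DNF (Fin n)) where

  dnf-model : ∀ t → Model (dnf→form Γ) t ⇔ (∃[ D ] (D ∈ Γ × (∀ p → p ∈ D → t p ≡ true)))
  dnf-model t = ⇔-trans (⋁-true (λ D → ⋀ (map var D)) t Γ)
    (mk⇔ (λ { (D , D∈Γ , e) → D , D∈Γ , to (⋀-true var t D) e })
         (λ { (D , D∈Γ , h) → D , D∈Γ , from (⋀-true var t D) h }))

  -- A minimal model is the indicator of one of the disjuncts: the indicator
  -- of the disjunct it satisfies is a model below it.
  minimal-model⇒disjunct : ∀ t → MinimalModel (dnf→form Γ) t → ∃[ D ] (D ∈ Γ × HasSupport t D)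
  minimal-model⇒disjunct t (model , minimal) with to (dnf-model t) model
  ... | D , D∈Γ , D⊆t = D , D∈Γ , λ p → mk⇔ (t⊆D p) (D⊆t p)
    where
    t⊆D : ∀ p → t p ≡ true → p ∈ D
    t⊆D p tp = to (indicator-support D p) (minimal (indicator D)
      (from (dnf-model (indicator D)) (D , D∈Γ , λ q → from (indicator-support D q)))
      (λ q e → D⊆t q (to (indicator-support D q) e)) p tp)

  -- In an irredundant DNF every disjunct's indicator is a minimal model:
  -- a model below it satisfies a disjunct contained in it, hence equal to it.
  disjunct⇒minimal-model : IrredundantDNF Γ → ∀ D → D ∈ Γ → MinimalModel (dnf→form Γ) (indicator D)
  disjunct⇒minimal-model irredundant D D∈Γ =
    from (dnf-model (indicator D)) (D , D∈Γ , λ q → from (indicator-support D q)) , minimal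
    where
    minimal : ∀ t → Model (dnf→form Γ) t → t ⊆v indicator D → indicator D ⊆v t
    minimal t model t⊆D with to (dnf-model t) model
    ... | D' , D'∈Γ , D'⊆t = λ p e → D'⊆t p
      (irredundant D' D D'∈Γ D∈Γ (λ q q∈D' → to (indicator-support D q) (t⊆D q (D'⊆t q q∈D')))
        p (to (indicator-support D p) e))

module _ (S : System) where
  open System S

  Leaves Enters : (Fin nS → Bool) → (Fin nP → Set) → Set
  Leaves β X = ∃[ p ] (X p × ∃[ s ] ∃[ s' ] (trans p ≡ just (s , s') × β s ≡ true))
  Enters β X = ∃[ p ] (X p × ∃[ s ] ∃[ s' ] (trans p ≡ just (s , s') × β s' ≡ true))

  TrapCondition : (Fin nS → Bool) → (Fin nP → Set) → Set
  TrapCondition β X = Leaves β X → Enters β X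

  trap-condition-transfer : ∀ β (X Y : Fin nP → Set) → (∀ p → X p ⇔ Y p) →
    TrapCondition β X → TrapCondition β Y
  trap-condition-transfer β X Y X⇔Y condition (p , Yp , leaving) with condition (p , from (X⇔Y p) Yp , leaving)
  ... | q , Xq , entering = q , to (X⇔Y q) Xq , entering

  pre-true : ∀ β p → ⟦ • p ⟧ β ≡ true ⇔ (∃[ s ] ∃[ s' ] (trans p ≡ just (s , s') × β s ≡ true))
  pre-true β p with trans p
  ... | just (s , s') = mk⇔ (λ e → s , s' , refl , e) (λ { (_ , _ , refl , e) → e })
  ... | nothing       = mk⇔ (λ ()) (λ { (_ , _ , () , _) })

  post-true : ∀ β p → ⟦ p • ⟧ β ≡ true ⇔ (∃[ s ] ∃[ s' ] (trans p ≡ just (s , s') × β s' ≡ true))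
  post-true β p with trans p
  ... | just (s , s') = mk⇔ (λ e → s , s' , refl , e) (λ { (_ , _ , refl , e) → e })
  ... | nothing       = mk⇔ (λ ()) (λ { (_ , _ , () , _) })

  Clause : List (Fin nP) → Form (Fin nS)
  Clause D = ⋁ (map •_ D) ⇒f ⋁ (map _• D)

  clause-true : ∀ β D → ⟦ Clause D ⟧ β ≡ true ⇔ TrapCondition β (_∈ D)
  clause-true β D = ⇔-trans (⇒-true _ _) (mk⇔ condition clause)
    where
    pre : ⟦ ⋁ (map •_ D) ⟧ β ≡ true ⇔ Leaves β (_∈ D)
    pre = ⇔-trans (⋁-true •_ β D)
      (mk⇔ (λ { (p , p∈D , e) → p , p∈D , to (pre-true β p) e })
           (λ { (p , p∈D , e) → p , p∈D , from (pre-true β p) e }))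

    post : ⟦ ⋁ (map _• D) ⟧ β ≡ true ⇔ Enters β (_∈ D)
    post = ⇔-trans (⋁-true _• β D)
      (mk⇔ (λ { (p , p∈D , e) → p , p∈D , to (post-true β p) e })
           (λ { (p , p∈D , e) → p , p∈D , from (post-true β p) e }))

    condition : (⟦ ⋁ (map •_ D) ⟧ β ≡ true → ⟦ ⋁ (map _• D) ⟧ β ≡ true) → TrapCondition β (_∈ D)
    condition implication leaving = to post (implication (from pre leaving))

    clause : TrapCondition β (_∈ D) → ⟦ ⋁ (map •_ D) ⟧ β ≡ true → ⟦ ⋁ (map _• D) ⟧ β ≡ true
    clause c e = from post (c (to pre e))

  Θ-true : ∀ β → Model Θ β ⇔ (∀ D → D ∈ Γ → TrapCondition β (_∈ D))
  Θ-true β = ⇔-trans (⋀-true Clause β Γ)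
    (mk⇔ (λ h D D∈Γ → to (clause-true β D) (h D D∈Γ))
         (λ h D D∈Γ → from (clause-true β D) (h D D∈Γ)))

  Fires : PetriNet.Trans (net S) → Fin nP → Set
  Fires t p = proj₁ t p ≡ true

  trap-true : ∀ β → Trap (net S) (tabulate β) ⇔ (∀ t → TrapCondition β (Fires t))
  trap-true β = mk⇔
    (λ trap t leaving → enters t (trap t (leaves t leaving)))
    (λ conditions t input → entered t (conditions t (left t input)))
    where
    leaves : ∀ t → Leaves β (Fires t) → ∃[ s ] (PetriNet.inArc (net S) s t × s Subset.∈ tabulate β)
    leaves t (p , fires , s , s' , eq , βs) = s , (p , fires , s' , eq) , from (∈-tabulate β s) βs

    left : ∀ t → ∃[ s ] (PetriNet.inArc (net S) s t × s Subset.∈ tabulate β) → Leaves β (Fires t)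
    left t (s , (p , fires , s' , eq) , s∈) = p , fires , s , s' , eq , to (∈-tabulate β s) s∈

    enters : ∀ t → ∃[ s' ] (PetriNet.outArc (net S) t s' × s' Subset.∈ tabulate β) → Enters β (Fires t)
    enters t (s' , (p , fires , s , eq) , s'∈) = p , fires , s , s' , eq , to (∈-tabulate β s') s'∈

    entered : ∀ t → Enters β (Fires t) → ∃[ s' ] (PetriNet.outArc (net S) t s' × s' Subset.∈ tabulate β)
    entered t (p , fires , s , s' , eq , βs') = s' , (p , fires , s , eq) , from (∈-tabulate β s') βs'

  -- Θ holds iff tabulate β is a trap: the transitions of the net and the
  -- disjuncts of Γ fire the same port sets.
  Θ⇔trap : IrredundantDNF Γ → ∀ β → Model Θ β ⇔ Trap (net S) (tabulate β)
  Θ⇔trap irredundant β = ⇔-trans (Θ-true β) (⇔-trans (mk⇔ transitions disjuncts) (⇔-sym (trap-true β)))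
    where

    transitions : (∀ D → D ∈ Γ → TrapCondition β (_∈ D)) → ∀ t → TrapCondition β (Fires t)
    transitions h t@(f , minimal) with minimal-model⇒disjunct Γ f minimal
    ... | D , D∈Γ , support =
      trap-condition-transfer β (_∈ D) (Fires t) (λ p → ⇔-sym (support p)) (h D D∈Γ)

    disjuncts : (∀ t → TrapCondition β (Fires t)) → ∀ D → D ∈ Γ → TrapCondition β (_∈ D)
    disjuncts h D D∈Γ = trap-condition-transfer β (Fires t) (_∈ D) (indicator-support D) (h t)
      where
      t : PetriNet.Trans (net S)
      t = indicator D , disjunct⇒minimal-model Γ irredundant D D∈Γ

  Init⇔marked : ∀ β → Model Init β ⇔ IsMarked (net S) (tabulate β)
  Init⇔marked β = ⇔-trans (⋁-true (λ k → var (init k)) β (allFin n))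
    (mk⇔ (λ { (k , _ , e) → init k , (k , refl) , from (∈-tabulate β (init k)) e })
         (λ { (s , (k , refl) , s∈) → k , ∈-allFin k , to (∈-tabulate β s) s∈ }))

  marked-trap : IrredundantDNF Γ → ∀ β → Model (Θ ∧f Init) β ⇔ MarkedTrap (net S) (tabulate β)
  marked-trap irredundant β = ⇔-trans (∧-true _ _) (Θ⇔trap irredundant β ×-⇔ Init⇔marked β)

lemma2 : (S : System) → IrredundantDNF (System.Γ S) →
    (β : Fin (System.nS S) → Bool) →
      (Model (System.Θ S ∧f System.Init S) β ⇔ MarkedTrap (net S) (tabulate β))
      × (MinimalModel (System.Θ S ∧f System.Init S) β ⇔ MinimalMarkedTrap (net S) (tabulate β))
lemma2 S irredundant β =
  marked-trap S irredundant β ,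
  minimality-transfer (Model (Θ ∧f Init)) (MarkedTrap (net S)) (marked-trap S irredundant) β
  where open System S
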